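{- Let $r\ge3$ and $1<s\le r$ be integers, let $a_1,\dots,a_r\in\Omega$ be defined recursively by $a_1=(a_r,\mathrm{id})\sigma$, $a_i=(\mathrm{id},a_{i-1})$ for $2\le i\le s-1$, $a_s=(\mathrm{id},a_{s-1})\sigma$, $a_i=(a_{i-1},\mathrm{id})$ for $s+1\le i\le r$, and let $G$ be the closed subgroup of $\Omega$ topologically generated by $a_1,\dots,a_r$. Then $G$ contains an odometer if and only if either $r$ and $s$ are both even, or $s$ is odd and $\frac{r}{\gcd(r,s-1)}$ is even.
   Context: $T$ is the regular rooted binary tree whose vertices are finite words over $\{0,1\}$ (level $n$ = words of length $n$); $\Omega=\mathrm{Aut}(T)$ with its profinite topology; automorphisms act on the right and $\gamma\gamma'$ means first $\gamma$ then $\gamma'$. Every $\gamma\in\Omega$ is written uniquely as $(\gamma_0,\gamma_1)\tau$ with $\tau\in\{\mathrm{id},\sigma\}$, meaning $(xv)\gamma=(x)\tau\,(v)\gamma_x$ for a letter $x$ and word $v$; $\sigma=(\mathrm{id},\mathrm{id})\sigma$ swaps the first letter. Multiplication: $(\gamma_0,\gamma_1)\tau\cdot(\gamma_0',\gamma_1')\tau'=(\gamma_0\gamma'_{(0)\tau},\gamma_1\gamma'_{(1)\tau})\tau\tau'$. An odometer is an element $\gamma\in\Omega$ that acts as a single $2^n$-cycle on level $n$ for every $n\ge1$. -}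

module Defs where

open import Data.Bool using (Bool; true; false; _xor_)
open import Data.Nat using (ℕ; zero; suc; _≡ᵇ_; _≤ᵇ_; _∸_; _/_; ≢-nonZero)
open import Data.Nat.GCD using (gcd; gcd[m,n]≢0)
open import Data.Fin using (Fin; toℕ)
open import Data.List using (List; []; _∷_; length)
open import Data.Maybe using (Maybe; just; nothing)
open import Data.Product using (_×_; _,_; ∃)
open import Data.Sum using (inj₁)
open import Relation.Binary.PropositionalEquality using (_≡_)

-- Vertices of the binary tree T: finite words over {0,1}; letter 0 = false, 1 = true.
Vertex : Set
Vertex = List Bool

-- An element of Ω = Aut(T) is given by its portrait: for each vertex v, whether
-- the section at v swaps the first letter (true = σ, false = id).
-- Every portrait is an automorphism and every automorphism has a unique portrait.
Aut : Set
Aut = Vertex → Bool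

sectionAt : Aut → Bool → Aut
sectionAt γ x u = γ (x ∷ u)

act : Aut → Vertex → Vertex
act γ [] = []
act γ (x ∷ v) = (x xor γ []) ∷ act (sectionAt γ x) v

actInv : Aut → Vertex → Vertex
actInv γ [] = []
actInv γ (y ∷ v) = (y xor γ []) ∷ actInv (sectionAt γ (y xor γ [])) v

identity : Aut
identity _ = false

rootSwap : ℕ → ℕ → ℕ → Bool
rootSwap r s i with i ≡ᵇ 1
... | true = true
... | false = i ≡ᵇ s

-- sectionIndex r s i x : the section (a_i)_x, as `just j` meaning a_j, or `nothing` meaning id.
--   a_1 = (a_r, id)σ
--   a_i = (id, a_{i-1})      for 2 ≤ i ≤ s-1
--   a_s = (id, a_{s-1})σ
--   a_i = (a_{i-1}, id)      for s+1 ≤ i ≤ r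
sectionIndex : ℕ → ℕ → ℕ → Bool → Maybe ℕ
sectionIndex r s i x with i ≡ᵇ 1 | i ≤ᵇ s | x
... | true  | _     | false = just r
... | true  | _     | true  = nothing
... | false | true  | false = nothing
... | false | true  | true  = just (i ∸ 1)
... | false | false | false = just (i ∸ 1)
... | false | false | true  = nothing

gen : ℕ → ℕ → ℕ → Aut
gen r s i [] = rootSwap r s i
gen r s i (x ∷ v) with sectionIndex r s i x
... | nothing = false
... | just j = gen r s j v

-- a letter of a group word: generator index k : Fin r (standing for a_{k+1}),
-- and a flag (true = inverse).
Letter : ℕ → Set
Letter r = Fin r × Bool

-- Action of the group element represented by a word (applied left to right,
-- matching the right-action convention).
actWord : (r s : ℕ) → List (Letter r) → Vertex → Vertex
actWord r s [] v = v
actWord r s ((k , false) ∷ w) v = actWord r s w (act (gen r s (suc (toℕ k))) v)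
actWord r s ((k , true) ∷ w) v = actWord r s w (actInv (gen r s (suc (toℕ k))) v)

-- γ lies in the closed subgroup G topologically generated by a_1,…,a_r:
-- γ is in the closure of the abstract subgroup ⟨a_1,…,a_r⟩ in the profinite
-- topology, i.e. for every level n some element of ⟨a_1,…,a_r⟩ agrees with γ on level n.
InG : (r s : ℕ) → Aut → Set
InG r s γ = ∀ (n : ℕ) → ∃ λ (w : List (Letter r)) →
  ∀ (v : Vertex) → length v ≡ n → act γ v ≡ actWord r s w v

iterate : (Vertex → Vertex) → ℕ → Vertex → Vertex
iterate f zero v = v
iterate f (suc k) v = f (iterate f k v)

IsOdometer : Aut → Set
IsOdometer γ = ∀ (n : ℕ) → 1 Data.Nat.≤ n → ∀ (v u : Vertex) → length v ≡ n → length u ≡ n →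
  ∃ λ (k : ℕ) → iterate (act γ) k v ≡ u

-- r / gcd(r, t) (for r ≥ 1; the value at r = 0 is irrelevant).
rOverGcd : ℕ → ℕ → ℕ
rOverGcd zero t = zero
rOverGcd (suc r) t = _/_ (suc r) (gcd (suc r) t) {{≢-nonZero (gcd[m,n]≢0 (suc r) t (inj₁ λ ()))}}

{-# OPTIONS --safe #-}
-- The number of vertices of level k at which γ swaps, taken mod 2, is a homomorphism
-- Ω → ℤ/2, and γ is transitive on level n iff this parity is odd on every level k < n
-- (γ must swap the root, and then the section of γ² at a letter must be transitive one
-- level lower). The generator a_{j+1} has odd parity exactly on the levels k ≡ j and
-- k ≡ j − (s − 1) (mod r). Since an element of G agrees up to level r with some word w,
-- it is an odometer iff the parities c(j) of the numbers of occurrences of a_{j+1} in w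
-- satisfy c(k) + c(k + s − 1) = 1 for all k ∈ ℤ/r, i.e. c alternates along the cycles of
-- translation by s − 1. These cycles have length r / gcd(r, s − 1), so such a c exists
-- iff that length is even, and then c(y) = ⌊y / gcd(r, s − 1)⌋ mod 2 works. For even s
-- the number gcd(r, s − 1) is odd, which turns the condition into the one of the theorem.
module Submission where

open import Defs
open import Algebra.Bundles using (CommutativeRing)
open import Data.Bool using (Bool; true; false; not; _xor_; _∧_)
open import Data.Bool.Properties
  using (xor-assoc; xor-comm; xor-identityʳ; xor-inverseʳ; not-involutive; not-injective; not-¬; ¬-not;
         not-distribˡ-xor; not-distribʳ-xor; ∧-zeroʳ; ∧-identityʳ; xor-∧-commutativeRing)
open import Data.Fin using (Fin; toℕ; fromℕ<)
open import Data.Fin.Properties using (toℕ<n; toℕ-fromℕ<)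
open import Data.List using (List; []; _∷_; length; replicate)
open import Data.List.Properties using (length-replicate; ∷-injectiveˡ; ∷-injectiveʳ)
open import Data.Nat
  using (ℕ; zero; suc; _+_; _*_; _∸_; _≤_; _<_; _≤ᵇ_; s≤s; z≤n; _≡ᵇ_; _/_; _%_; NonZero; ≢-nonZero)
open import Data.Nat.Properties
  using (_≟_; +-comm; +-suc; suc-injective; ≤-refl; <⇒≤; <⇒≢; m≤n⇒m<n∨m≡n; ≤-pred)
open import Data.Nat.DivMod
  using (%-distribˡ-+; m%n%n≡m%n; m%n<n; m<n⇒m%n≡m; n%n≡0; m≡m%n+[m/n]*n; m/n*n≡m;
         +-distrib-/-∣ʳ; *-/-assoc)
open import Data.Nat.Divisibility
  using (_∣_; divides; _∣?_; ∣-refl; ∣-trans; ∣1⇒≡1; ∣m∣n⇒∣m+n; ∣m+n∣m⇒∣n; ∣n⇒∣m*n;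
         *-monoʳ-∣; m/n∣m; n∣m⇒m%n≡0)
open import Data.Nat.GCD using (gcd; gcd[m,n]∣m; gcd[m,n]∣n; gcd[m,n]≢0)
open import Data.Nat.Coprimality using (coprime-/gcd)
open import Data.Nat.Primality using (prime[2]; euclidsLemma)
open import Data.Product using (_×_; _,_; ∃; proj₁; proj₂)
open import Data.Sum using (_⊎_; inj₁; inj₂; [_,_])
open import Function using (_∘_; id)
open import Function.Bundles using (_⇔_; mk⇔; module Equivalence)
open import Relation.Nullary using (¬_; yes; no; contradiction)
open import Relation.Nullary.Decidable using (dec-true; dec-false)
open import Relation.Binary.PropositionalEquality
  using (_≡_; refl; sym; trans; cong; cong₂; subst; _≗_; module ≡-Reasoning)
open import Algebra.Properties.CommutativeSemigroup
  (CommutativeRing.+-commutativeSemigroup xor-∧-commutativeRing) using (interchange)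

open ≡-Reasoning

-- Parity and alternating colourings of ℤ/r

odd : ℕ → Bool
odd zero = false
odd (suc n) = not (odd n)

odd-+ : ∀ m n → odd (m + n) ≡ odd m xor odd n
odd-+ zero n = refl
odd-+ (suc m) n = trans (cong not (odd-+ m n)) (not-distribˡ-xor (odd m) (odd n))

odd[m*2]≡false : ∀ m → odd (m * 2) ≡ false
odd[m*2]≡false zero = refl
odd[m*2]≡false (suc m) = trans (not-involutive (odd (m * 2))) (odd[m*2]≡false m)

2∣⇒odd≡false : ∀ {n} → 2 ∣ n → odd n ≡ false
2∣⇒odd≡false (divides m refl) = odd[m*2]≡false m

odd≡false⇒2∣ : ∀ n → odd n ≡ false → 2 ∣ n
odd≡false⇒2∣ zero _ = divides 0 refl
odd≡false⇒2∣ (suc (suc n)) even =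
  ∣m∣n⇒∣m+n ∣-refl (odd≡false⇒2∣ n (trans (sym (not-involutive (odd n))) even))

¬2∣⇒odd≡true : ∀ {n} → ¬ 2 ∣ n → odd n ≡ true
¬2∣⇒odd≡true {n} 2∤n = ¬-not (2∤n ∘ odd≡false⇒2∣ n)

even⊎odd : ∀ t → ∃ λ h → t ≡ h + h ⊎ t ≡ suc (h + h)
even⊎odd zero = 0 , inj₁ refl
even⊎odd (suc t) with even⊎odd t
... | h , inj₁ refl = h , inj₂ refl
... | h , inj₂ refl = suc h , inj₁ (cong suc (sym (+-suc h h)))

xor≡true⇒≡not : ∀ a {b} → a xor b ≡ true → b ≡ not a
xor≡true⇒≡not false eq = eq
xor≡true⇒≡not true eq = not-injective eq

[m%n+k]%n≡[m+k]%n : ∀ m k n .{{_ : NonZero n}} → (m % n + k) % n ≡ (m + k) % n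
[m%n+k]%n≡[m+k]%n m k n = begin
  (m % n + k) % n          ≡⟨ %-distribˡ-+ (m % n) k n ⟩
  (m % n % n + k % n) % n  ≡⟨ cong (λ x → (x + k % n) % n) (m%n%n≡m%n m n) ⟩
  (m % n + k % n) % n      ≡⟨ %-distribˡ-+ m k n ⟨
  (m + k) % n              ∎

m∣[m/gcd[m,n]]*n : ∀ m n .{{_ : NonZero (gcd m n)}} → m ∣ (m / gcd m n) * n
m∣[m/gcd[m,n]]*n m n =
  subst (_∣ (m / gcd m n) * n) (m/n*n≡m (gcd[m,n]∣m m n)) (*-monoʳ-∣ (m / gcd m n) (gcd[m,n]∣n m n))

2∣m/gcd[m,n]⇒¬2∣n/gcd[m,n] : ∀ m n .{{_ : NonZero (gcd m n)}} →
  2 ∣ m / gcd m n → ¬ 2 ∣ n / gcd m n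
2∣m/gcd[m,n]⇒¬2∣n/gcd[m,n] m n 2∣m′ 2∣n′ = contradiction (coprime-/gcd m n (2∣m′ , 2∣n′)) λ ()

[2∣m×2∣1+n]⊎[2∤1+n×2∣m/gcd]⇔2∣m/gcd : ∀ m n .{{_ : NonZero (gcd m n)}} →
  ((2 ∣ m × 2 ∣ suc n) ⊎ (¬ 2 ∣ suc n × 2 ∣ m / gcd m n)) ⇔ 2 ∣ m / gcd m n
[2∣m×2∣1+n]⊎[2∤1+n×2∣m/gcd]⇔2∣m/gcd m n = mk⇔ to from
  where
  to : (2 ∣ m × 2 ∣ suc n) ⊎ (¬ 2 ∣ suc n × 2 ∣ m / gcd m n) → 2 ∣ m / gcd m n
  to (inj₂ (_ , 2∣m′)) = 2∣m′
  to (inj₁ (2∣m , 2∣1+n)) =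
    [ id , (λ 2∣gcd → contradiction 2∣gcd 2∤gcd) ]
      (euclidsLemma (m / gcd m n) (gcd m n) prime[2] (subst (2 ∣_) (sym (m/n*n≡m (gcd[m,n]∣m m n))) 2∣m))
    where
    2∤n : ¬ 2 ∣ n
    2∤n 2∣n = contradiction (∣1⇒≡1 (∣m+n∣m⇒∣n (subst (2 ∣_) (+-comm 1 n) 2∣1+n) 2∣n)) λ ()
    2∤gcd : ¬ 2 ∣ gcd m n
    2∤gcd 2∣gcd = 2∤n (∣-trans 2∣gcd (gcd[m,n]∣n m n))
  from : 2 ∣ m / gcd m n → (2 ∣ m × 2 ∣ suc n) ⊎ (¬ 2 ∣ suc n × 2 ∣ m / gcd m n)
  from 2∣m′ with 2 ∣? suc n
  ... | yes 2∣1+n = inj₁ (∣-trans 2∣m′ (m/n∣m (gcd[m,n]∣m m n)) , 2∣1+n)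
  ... | no 2∤1+n = inj₂ (2∤1+n , 2∣m′)

Periodic : (r : ℕ) .{{_ : NonZero r}} → (ℕ → Bool) → Set
Periodic r f = ∀ y → f (y % r) ≡ f y

Alternates : ℕ → (ℕ → Bool) → Set
Alternates d f = ∀ y → f (y + d) ≡ not (f y)

alternates-multiple : ∀ {d f} → Alternates d f → ∀ t → f (t * d) ≡ f 0 xor odd t
alternates-multiple {f = f} alt zero = sym (xor-identityʳ (f 0))
alternates-multiple {d} {f} alt (suc t) = begin
  f (d + t * d)        ≡⟨ cong f (+-comm d (t * d)) ⟩
  f (t * d + d)        ≡⟨ alt (t * d) ⟩
  not (f (t * d))      ≡⟨ cong not (alternates-multiple alt t) ⟩
  not (f 0 xor odd t)  ≡⟨ not-distribʳ-xor (f 0) (odd t) ⟩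
  f 0 xor odd (suc t)  ∎

periodic∧alternates⇒2∣ : ∀ {r d t f} .{{_ : NonZero r}} →
  Periodic r f → Alternates d f → r ∣ t * d → 2 ∣ t
periodic∧alternates⇒2∣ {r} {d} {t} {f} periodic alternates r∣td with odd t in odd-t
... | false = odd≡false⇒2∣ t odd-t
... | true = contradiction f0≡not[f0] (not-¬ refl)
  where
  f0≡not[f0] : f 0 ≡ not (f 0)
  f0≡not[f0] = begin
    f 0                ≡⟨ cong f (n∣m⇒m%n≡0 (t * d) r r∣td) ⟨
    f ((t * d) % r)    ≡⟨ periodic (t * d) ⟩
    f (t * d)          ≡⟨ alternates-multiple alternates t ⟩
    f 0 xor odd t      ≡⟨ cong (f 0 xor_) odd-t ⟩
    f 0 xor true       ≡⟨ xor-comm (f 0) true ⟩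
    not (f 0)          ∎

periodic∧alternates⇒2∣r/gcd : ∀ {r d f} .{{_ : NonZero r}} .{{_ : NonZero (gcd r d)}} →
  Periodic r f → Alternates d f → 2 ∣ r / gcd r d
periodic∧alternates⇒2∣r/gcd {r} {d} periodic alternates =
  periodic∧alternates⇒2∣ periodic alternates (m∣[m/gcd[m,n]]*n r d)

module AlternatingColouring (r d : ℕ) .{{_ : NonZero r}} .{{_ : NonZero (gcd r d)}}
                            (2∣r/gcd : 2 ∣ r / gcd r d) where

  colour : ℕ → Bool
  colour y = odd (y / gcd r d)

  colour-periodic : Periodic r colour
  colour-periodic y = sym (begin
    odd (y / g)                                  ≡⟨ cong (odd ∘ (_/ g)) (m≡m%n+[m/n]*n y r) ⟩
    odd ((y % r + y / r * r) / g)                ≡⟨ cong odd (+-distrib-/-∣ʳ (y % r) g∣[y/r]*r) ⟩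
    odd ((y % r) / g + y / r * r / g)            ≡⟨ odd-+ ((y % r) / g) (y / r * r / g) ⟩
    odd ((y % r) / g) xor odd (y / r * r / g)    ≡⟨ cong (odd ((y % r) / g) xor_) (2∣⇒odd≡false 2∣[y/r]*r/g) ⟩
    odd ((y % r) / g) xor false                  ≡⟨ xor-identityʳ _ ⟩
    odd ((y % r) / g)                            ∎)
    where
    g : ℕ
    g = gcd r d
    g∣[y/r]*r : g ∣ y / r * r
    g∣[y/r]*r = ∣n⇒∣m*n (y / r) (gcd[m,n]∣m r d)
    2∣[y/r]*r/g : 2 ∣ y / r * r / g
    2∣[y/r]*r/g = subst (2 ∣_) (sym (*-/-assoc (y / r) (gcd[m,n]∣m r d))) (∣n⇒∣m*n (y / r) 2∣r/gcd)

  colour-alternates : Alternates d colour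
  colour-alternates y = begin
    odd ((y + d) / g)              ≡⟨ cong odd (+-distrib-/-∣ʳ y (gcd[m,n]∣n r d)) ⟩
    odd (y / g + d / g)            ≡⟨ odd-+ (y / g) (d / g) ⟩
    odd (y / g) xor odd (d / g)    ≡⟨ cong (odd (y / g) xor_) (¬2∣⇒odd≡true 2∤d/g) ⟩
    odd (y / g) xor true           ≡⟨ xor-comm (odd (y / g)) true ⟩
    not (odd (y / g))              ∎
    where
    g : ℕ
    g = gcd r d
    2∤d/g : ¬ 2 ∣ d / g
    2∤d/g = 2∣m/gcd[m,n]⇒¬2∣n/gcd[m,n] r d 2∣r/gcd

-- Portraits and level parities

infixl 7 _·_
infix 8 _⁻¹

_·_ : Aut → Aut → Aut
(α · β) v = α v xor β (act α v)

_⁻¹ : Aut → Aut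
(α ⁻¹) v = α (actInv α v)

act-· : ∀ α β v → act (α · β) v ≡ act β (act α v)
act-· α β [] = refl
act-· α β (x ∷ v) =
  cong₂ _∷_ (sym (xor-assoc x (α []) (β []))) (act-· (sectionAt α x) (sectionAt β (x xor α [])) v)

act-⁻¹ : ∀ α v → act (α ⁻¹) v ≡ actInv α v
act-⁻¹ α [] = refl
act-⁻¹ α (x ∷ v) = cong ((x xor α []) ∷_) (act-⁻¹ (sectionAt α (x xor α [])) v)

act-identity : ∀ v → act identity v ≡ v
act-identity [] = refl
act-identity (x ∷ v) = cong₂ _∷_ (xor-identityʳ x) (act-identity v)

length-act : ∀ γ v → length (act γ v) ≡ length v
length-act γ [] = refl
length-act γ (x ∷ v) = cong suc (length-act (sectionAt γ x) v)

infix 4 _≗[_]_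

_≗[_]_ : {A : Set} → (Vertex → A) → ℕ → (Vertex → A) → Set
f ≗[ n ] g = ∀ v → length v ≡ n → f v ≡ g v

portrait-≗-below : ∀ {n} γ δ → act γ ≗[ n ] act δ → ∀ {k} → k < n → γ ≗[ k ] δ
portrait-≗-below {suc n} γ δ γ≗δ _ [] refl =
  ∷-injectiveˡ (γ≗δ (false ∷ replicate n false) (cong suc (length-replicate n)))
portrait-≗-below {suc n} γ δ γ≗δ (s≤s k<n) (x ∷ u) refl =
  portrait-≗-below (sectionAt γ x) (sectionAt δ x)
    (λ v lv → ∷-injectiveʳ (γ≗δ (x ∷ v) (cong suc lv))) k<n u refl

levelParity : Aut → ℕ → Bool
levelParity γ zero = γ []
levelParity γ (suc k) = levelParity (sectionAt γ false) k xor levelParity (sectionAt γ true) k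

levelParity-cong : ∀ k {γ δ} → γ ≗[ k ] δ → levelParity γ k ≡ levelParity δ k
levelParity-cong zero γ≗δ = γ≗δ [] refl
levelParity-cong (suc k) γ≗δ = cong₂ _xor_
  (levelParity-cong k (λ u lu → γ≗δ (false ∷ u) (cong suc lu)))
  (levelParity-cong k (λ u lu → γ≗δ (true ∷ u) (cong suc lu)))

levelParity-identity : ∀ k → levelParity identity k ≡ false
levelParity-identity zero = refl
levelParity-identity (suc k) = cong₂ _xor_ (levelParity-identity k) (levelParity-identity k)

levelParity-sections : ∀ k γ x →
  levelParity (sectionAt γ x) k xor levelParity (sectionAt γ (not x)) k ≡ levelParity γ (suc k)
levelParity-sections k γ false = refl
levelParity-sections k γ true =
  xor-comm (levelParity (sectionAt γ true) k) (levelParity (sectionAt γ false) k)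

levelParity-· : ∀ k α β → levelParity (α · β) k ≡ levelParity α k xor levelParity β k
levelParity-· zero α β = refl
levelParity-· (suc k) α β = begin
  levelParity (α₀ · sectionAt β (α [])) k xor levelParity (α₁ · sectionAt β (not (α []))) k
    ≡⟨ cong₂ _xor_ (levelParity-· k α₀ _) (levelParity-· k α₁ _) ⟩
  (levelParity α₀ k xor levelParity (sectionAt β (α [])) k) xor
  (levelParity α₁ k xor levelParity (sectionAt β (not (α []))) k)
    ≡⟨ interchange (levelParity α₀ k) _ (levelParity α₁ k) _ ⟩
  levelParity α (suc k) xor
  (levelParity (sectionAt β (α [])) k xor levelParity (sectionAt β (not (α []))) k)
    ≡⟨ cong (levelParity α (suc k) xor_) (levelParity-sections k β (α [])) ⟩
  levelParity α (suc k) xor levelParity β (suc k) ∎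
  where
  α₀ α₁ : Aut
  α₀ = sectionAt α false
  α₁ = sectionAt α true

levelParity-⁻¹ : ∀ k α → levelParity (α ⁻¹) k ≡ levelParity α k
levelParity-⁻¹ zero α = refl
levelParity-⁻¹ (suc k) α =
  trans (cong₂ _xor_ (levelParity-⁻¹ k (sectionAt α (α []))) (levelParity-⁻¹ k (sectionAt α (not (α [])))))
        (levelParity-sections k α (α []))

levelParity-singleSection : ∀ k γ x → sectionAt γ (not x) ≗[ k ] identity →
  levelParity γ (suc k) ≡ levelParity (sectionAt γ x) k
levelParity-singleSection k γ x trivial = begin
  levelParity γ (suc k)
    ≡⟨ levelParity-sections k γ x ⟨
  levelParity (sectionAt γ x) k xor levelParity (sectionAt γ (not x)) k
    ≡⟨ cong (levelParity (sectionAt γ x) k xor_) (trans (levelParity-cong k trivial) (levelParity-identity k)) ⟩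
  levelParity (sectionAt γ x) k xor false
    ≡⟨ xor-identityʳ _ ⟩
  levelParity (sectionAt γ x) k ∎

-- Transitivity on a level

LevelTransitive : Aut → ℕ → Set
LevelTransitive γ n = ∀ v u → length v ≡ n → length u ≡ n → ∃ λ k → iterate (act γ) k v ≡ u

iterate-suc : ∀ f t (v : Vertex) → iterate f (suc t) v ≡ iterate f t (f v)
iterate-suc f zero v = refl
iterate-suc f (suc t) v = cong f (iterate-suc f t v)

-- When γ swaps the root, this is the section of γ² at x.
squareSection : Aut → Bool → Aut
squareSection γ x = sectionAt γ x · sectionAt γ (not x)

levelParity-squareSection : ∀ k γ x → levelParity (squareSection γ x) k ≡ levelParity γ (suc k)
levelParity-squareSection k γ x = trans (levelParity-· k _ _) (levelParity-sections k γ x)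

module RootSwap {γ : Aut} (swaps : γ [] ≡ true) where

  act-∷ : ∀ x v → act γ (x ∷ v) ≡ not x ∷ act (sectionAt γ x) v
  act-∷ x v rewrite swaps = cong (_∷ act (sectionAt γ x) v) (xor-comm x true)

  act²-∷ : ∀ x v → act γ (act γ (x ∷ v)) ≡ x ∷ act (squareSection γ x) v
  act²-∷ x v = begin
    act γ (act γ (x ∷ v))
      ≡⟨ cong (act γ) (act-∷ x v) ⟩
    act γ (not x ∷ act (sectionAt γ x) v)
      ≡⟨ act-∷ (not x) _ ⟩
    not (not x) ∷ act (sectionAt γ (not x)) (act (sectionAt γ x) v)
      ≡⟨ cong₂ _∷_ (not-involutive x) (sym (act-· _ _ v)) ⟩
    x ∷ act (squareSection γ x) v ∎

  iterate-even : ∀ x v t → iterate (act γ) (t + t) (x ∷ v) ≡ x ∷ iterate (act (squareSection γ x)) t v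
  iterate-even x v zero = refl
  iterate-even x v (suc t) rewrite +-suc t t | iterate-even x v t = act²-∷ x _

  iterate-odd : ∀ x v t → ∃ λ w → iterate (act γ) (suc (t + t)) (x ∷ v) ≡ not x ∷ w
  iterate-odd x v t rewrite iterate-even x v t = _ , act-∷ x _

iterate-rootFixed : ∀ {γ} → γ [] ≡ false → ∀ x v t → ∃ λ w → iterate (act γ) t (x ∷ v) ≡ x ∷ w
iterate-rootFixed fixes x v zero = v , refl
iterate-rootFixed {γ} fixes x v (suc t) with iterate-rootFixed {γ} fixes x v t
... | w , eq rewrite eq =
  _ , cong (_∷ act (sectionAt γ x) w) (trans (cong (x xor_) fixes) (xor-identityʳ x))

oddLevelParities⇒levelTransitive : ∀ n γ → (∀ k → k < n → levelParity γ k ≡ true) → LevelTransitive γ n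
oddLevelParities⇒levelTransitive zero γ _ [] [] _ _ = 0 , refl
oddLevelParities⇒levelTransitive (suc n) γ oddLevels (x ∷ v) (y ∷ u) lv lu = reach x y
  where
  open RootSwap {γ} (oddLevels 0 (s≤s z≤n))

  squareTransitive : ∀ z → LevelTransitive (squareSection γ z) n
  squareTransitive z = oddLevelParities⇒levelTransitive n (squareSection γ z)
    (λ k k<n → trans (levelParity-squareSection k γ z) (oddLevels (suc k) (s≤s k<n)))

  sameRoot : ∀ z w → length w ≡ n → ∃ λ t → iterate (act γ) t (z ∷ w) ≡ z ∷ u
  sameRoot z w lw with squareTransitive z w u lw (suc-injective lu)
  ... | t , reaches = t + t , trans (iterate-even z w t) (cong (z ∷_) reaches)

  otherRoot : ∀ z → ∃ λ t → iterate (act γ) t (z ∷ v) ≡ not z ∷ u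
  otherRoot z with sameRoot (not z) (act (sectionAt γ z) v) (trans (length-act _ v) (suc-injective lv))
  ... | t , reaches =
    suc t , trans (iterate-suc (act γ) t (z ∷ v)) (trans (cong (iterate (act γ) t) (act-∷ z v)) reaches)

  reach : ∀ a b → ∃ λ t → iterate (act γ) t (a ∷ v) ≡ b ∷ u
  reach false false = sameRoot false v (suc-injective lv)
  reach true true = sameRoot true v (suc-injective lv)
  reach false true = otherRoot false
  reach true false = otherRoot true

rootFixed⇒¬levelTransitive : ∀ {n γ} → γ [] ≡ false → ¬ LevelTransitive γ (suc n)
rootFixed⇒¬levelTransitive {n} fixes transitive =
  let t , reaches = transitive (false ∷ zeros) (true ∷ zeros) length-zeros length-zeros
      w , fixed = iterate-rootFixed fixes false zeros t
  in contradiction (∷-injectiveˡ (trans (sym fixed) reaches)) λ ()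
  where
  zeros : Vertex
  zeros = replicate n false
  length-zeros : length (false ∷ zeros) ≡ suc n
  length-zeros = cong suc (length-replicate n)

levelTransitive⇒rootSwap : ∀ {n} γ → LevelTransitive γ (suc n) → γ [] ≡ true
levelTransitive⇒rootSwap γ transitive with γ [] in fixes
... | true = refl
... | false = contradiction transitive (rootFixed⇒¬levelTransitive fixes)

squareSection-levelTransitive : ∀ {n} γ x → γ [] ≡ true → LevelTransitive γ (suc n) →
  LevelTransitive (squareSection γ x) n
squareSection-levelTransitive γ x swaps transitive v u lv lu
  with transitive (x ∷ v) (x ∷ u) (cong suc lv) (cong suc lu)
... | t , reaches with even⊎odd t
...   | h , inj₁ refl = h , ∷-injectiveʳ (trans (sym (RootSwap.iterate-even swaps x v h)) reaches)
...   | h , inj₂ refl =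
  let w , flipped = RootSwap.iterate-odd swaps x v h
  in contradiction (sym (∷-injectiveˡ (trans (sym flipped) reaches))) (not-¬ refl)

levelTransitive⇒oddLevelParity : ∀ {n} γ → LevelTransitive γ n → ∀ {k} → k < n →
  levelParity γ k ≡ true
levelTransitive⇒oddLevelParity γ transitive {zero} (s≤s _) = levelTransitive⇒rootSwap γ transitive
levelTransitive⇒oddLevelParity γ transitive {suc k} (s≤s k<n) = begin
  levelParity γ (suc k)                   ≡⟨ levelParity-squareSection k γ false ⟨
  levelParity (squareSection γ false) k   ≡⟨ levelTransitive⇒oddLevelParity (squareSection γ false)
                                               (squareSection-levelTransitive γ false swaps transitive) k<n ⟩
  true                                    ∎
  where
  swaps : γ [] ≡ true
  swaps = levelTransitive⇒rootSwap γ transitive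

-- Words in the generators

letterAut : (r s : ℕ) → Letter r → Aut
letterAut r s (i , false) = gen r s (suc (toℕ i))
letterAut r s (i , true) = gen r s (suc (toℕ i)) ⁻¹

wordAut : (r s : ℕ) → List (Letter r) → Aut
wordAut r s [] = identity
wordAut r s (l ∷ w) = letterAut r s l · wordAut r s w

act-wordAut : ∀ r s w → act (wordAut r s w) ≗ actWord r s w
act-wordAut r s [] v = act-identity v
act-wordAut r s ((i , false) ∷ w) v = trans (act-· _ (wordAut r s w) v) (act-wordAut r s w _)
act-wordAut r s ((i , true) ∷ w) v =
  trans (act-· _ (wordAut r s w) v) (trans (cong (act (wordAut r s w)) (act-⁻¹ _ v)) (act-wordAut r s w _))

wordAut∈G : ∀ r s w → InG r s (wordAut r s w)
wordAut∈G r s w n = w , λ v _ → act-wordAut r s w v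

levelParity-letterAut : ∀ r s i b k →
  levelParity (letterAut r s (i , b)) k ≡ levelParity (gen r s (suc (toℕ i))) k
levelParity-letterAut r s i false k = refl
levelParity-letterAut r s i true k = levelParity-⁻¹ k _

occurrenceParity : ∀ {r} → List (Letter r) → ℕ → Bool
occurrenceParity [] a = false
occurrenceParity ((i , _) ∷ w) a = (toℕ i ≡ᵇ a) xor occurrenceParity w a

prependIf : ∀ {r} → Bool → Letter r → List (Letter r) → List (Letter r)
prependIf true l w = l ∷ w
prependIf false l w = w

occurrenceParity-prependIf : ∀ {r} b (i : Fin r) c w a →
  occurrenceParity (prependIf b (i , c) w) a ≡ (b ∧ (toℕ i ≡ᵇ a)) xor occurrenceParity w a
occurrenceParity-prependIf true i c w a = refl
occurrenceParity-prependIf false i c w a = refl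

indicatorWord : ∀ {r} → (ℕ → Bool) → ∀ m → m ≤ r → List (Letter r)
indicatorWord c zero _ = []
indicatorWord c (suc m) m<r = prependIf (c m) (fromℕ< m<r , false) (indicatorWord c m (<⇒≤ m<r))

occurrenceParity-indicatorWord-suc : ∀ {r} c m (m<r : m < r) a →
  occurrenceParity (indicatorWord c (suc m) m<r) a
    ≡ (c m ∧ (m ≡ᵇ a)) xor occurrenceParity (indicatorWord c m (<⇒≤ m<r)) a
occurrenceParity-indicatorWord-suc {r} c m m<r a =
  trans (occurrenceParity-prependIf (c m) (fromℕ< m<r) false w a)
        (cong (λ j → (c m ∧ (j ≡ᵇ a)) xor occurrenceParity w a) (toℕ-fromℕ< m<r))
  where
  w : List (Letter r)
  w = indicatorWord c m (<⇒≤ m<r)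

occurrenceParity-indicatorWord-≥ : ∀ {r} c m (m≤r : m ≤ r) {a} → m ≤ a →
  occurrenceParity (indicatorWord c m m≤r) a ≡ false
occurrenceParity-indicatorWord-≥ c zero _ _ = refl
occurrenceParity-indicatorWord-≥ c (suc m) m<r {a} m<a = begin
  occurrenceParity (indicatorWord c (suc m) m<r) a
    ≡⟨ occurrenceParity-indicatorWord-suc c m m<r a ⟩
  (c m ∧ (m ≡ᵇ a)) xor occurrenceParity (indicatorWord c m _) a
    ≡⟨ cong₂ (λ b → (c m ∧ b) xor_) (dec-false (m ≟ a) (<⇒≢ m<a))
                                    (occurrenceParity-indicatorWord-≥ c m (<⇒≤ m<r) (<⇒≤ m<a)) ⟩
  (c m ∧ false) xor false
    ≡⟨ trans (xor-identityʳ _) (∧-zeroʳ (c m)) ⟩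
  false ∎

occurrenceParity-indicatorWord-< : ∀ {r} c m (m≤r : m ≤ r) {a} → a < m →
  occurrenceParity (indicatorWord c m m≤r) a ≡ c a
occurrenceParity-indicatorWord-< c (suc m) m<r {a} a<1+m with m≤n⇒m<n∨m≡n (≤-pred a<1+m)
... | inj₁ a<m = begin
  occurrenceParity (indicatorWord c (suc m) m<r) a
    ≡⟨ occurrenceParity-indicatorWord-suc c m m<r a ⟩
  (c m ∧ (m ≡ᵇ a)) xor occurrenceParity (indicatorWord c m _) a
    ≡⟨ cong₂ (λ b → (c m ∧ b) xor_) (dec-false (m ≟ a) (<⇒≢ a<m ∘ sym))
                                    (occurrenceParity-indicatorWord-< c m (<⇒≤ m<r) a<m) ⟩
  (c m ∧ false) xor c a
    ≡⟨ cong (_xor c a) (∧-zeroʳ (c m)) ⟩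
  c a ∎
... | inj₂ refl = begin
  occurrenceParity (indicatorWord c (suc a) m<r) a
    ≡⟨ occurrenceParity-indicatorWord-suc c a m<r a ⟩
  (c a ∧ (a ≡ᵇ a)) xor occurrenceParity (indicatorWord c a _) a
    ≡⟨ cong₂ (λ b → (c a ∧ b) xor_) (dec-true (a ≟ a) refl)
                                    (occurrenceParity-indicatorWord-≥ c a (<⇒≤ m<r) ≤-refl) ⟩
  (c a ∧ true) xor false
    ≡⟨ trans (xor-identityʳ _) (∧-identityʳ (c a)) ⟩
  c a ∎

-- r = n + 2 and s = e + 2, so that 2 ≤ s ≤ r, and d = s − 1. An index j < r stands for a_{j+1}.
module Generators (n e : ℕ) (e≤n : e ≤ n) where

  r s d : ℕ
  r = suc (suc n)
  s = suc (suc e)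
  d = suc e

  instance
    gcd[r,d]-nonZero : NonZero (gcd r d)
    gcd[r,d]-nonZero = ≢-nonZero (gcd[m,n]≢0 r d (inj₁ λ ()))

  d<r : d < r
  d<r = s≤s (s≤s e≤n)

  previous : ℕ → ℕ
  previous zero = suc n
  previous (suc j) = j

  previous< : ∀ {j} → j < r → previous j < r
  previous< {zero} _ = ≤-refl
  previous< {suc j} j<r = <⇒≤ j<r

  previous-≡ᵇ : ∀ {j a} → j < r → a < r → (previous j ≡ᵇ a) ≡ (j ≡ᵇ suc a % r)
  previous-≡ᵇ {j} {a} j<r a<r with m≤n⇒m<n∨m≡n a<r
  ... | inj₁ 1+a<r = trans (lemma j) (cong (j ≡ᵇ_) (sym (m<n⇒m%n≡m 1+a<r)))
    where
    lemma : ∀ j → (previous j ≡ᵇ a) ≡ (j ≡ᵇ suc a)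
    lemma zero = dec-false (suc n ≟ a) (<⇒≢ (≤-pred 1+a<r) ∘ sym)
    lemma (suc j) = refl
  ... | inj₂ refl = trans (lemma j j<r) (cong (j ≡ᵇ_) (sym (n%n≡0 r)))
    where
    lemma : ∀ j → j < r → (previous j ≡ᵇ suc n) ≡ (j ≡ᵇ 0)
    lemma zero _ = dec-true (suc n ≟ suc n) refl
    lemma (suc j) j<r = dec-false (j ≟ suc n) (<⇒≢ (≤-pred j<r))

  previous-≡ᵇ-% : ∀ {j} → j < r → ∀ t → (previous j ≡ᵇ t % r) ≡ (j ≡ᵇ suc t % r)
  previous-≡ᵇ-% {j} j<r t = trans (previous-≡ᵇ j<r (m%n<n t r)) (cong (j ≡ᵇ_) (sym (%-distribˡ-+ 1 t r)))

  gen-singleSection : ∀ j → ∃ λ x → sectionAt (gen r s (suc j)) x ≗ gen r s (suc (previous j))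
                                   × sectionAt (gen r s (suc j)) (not x) ≗ identity
  gen-singleSection zero = false , (λ _ → refl) , (λ _ → refl)
  gen-singleSection (suc j) with suc (suc j) ≤ᵇ s
  ... | true = true , (λ _ → refl) , (λ _ → refl)
  ... | false = false , (λ _ → refl) , (λ _ → refl)

  levelParity-gen : ∀ k {j} → j < r →
    levelParity (gen r s (suc j)) k ≡ (j ≡ᵇ k % r) xor (j ≡ᵇ (k + d) % r)
  levelParity-gen zero {zero} _ = cong (λ x → true xor (0 ≡ᵇ x)) (sym (m<n⇒m%n≡m d<r))
  levelParity-gen zero {suc j} _ = cong (λ x → suc j ≡ᵇ x) (sym (m<n⇒m%n≡m d<r))
  levelParity-gen (suc k) {j} j<r with gen-singleSection j
  ... | x , section≗previous , otherSection≗identity = begin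
    levelParity (gen r s (suc j)) (suc k)
      ≡⟨ levelParity-singleSection k (gen r s (suc j)) x (λ u _ → otherSection≗identity u) ⟩
    levelParity (sectionAt (gen r s (suc j)) x) k
      ≡⟨ levelParity-cong k (λ u _ → section≗previous u) ⟩
    levelParity (gen r s (suc (previous j))) k
      ≡⟨ levelParity-gen k (previous< j<r) ⟩
    (previous j ≡ᵇ k % r) xor (previous j ≡ᵇ (k + d) % r)
      ≡⟨ cong₂ _xor_ (previous-≡ᵇ-% j<r k) (previous-≡ᵇ-% j<r (k + d)) ⟩
    (j ≡ᵇ suc k % r) xor (j ≡ᵇ (suc k + d) % r) ∎

  levelParity-wordAut : ∀ w k →
    levelParity (wordAut r s w) k ≡ occurrenceParity w (k % r) xor occurrenceParity w ((k + d) % r)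
  levelParity-wordAut [] k = levelParity-identity k
  levelParity-wordAut ((i , b) ∷ w) k = begin
    levelParity (letterAut r s (i , b) · wordAut r s w) k
      ≡⟨ levelParity-· k _ _ ⟩
    levelParity (letterAut r s (i , b)) k xor levelParity (wordAut r s w) k
      ≡⟨ cong₂ _xor_ (trans (levelParity-letterAut r s i b k) (levelParity-gen k (toℕ<n i)))
                     (levelParity-wordAut w k) ⟩
    ((toℕ i ≡ᵇ k % r) xor (toℕ i ≡ᵇ (k + d) % r)) xor
    (occurrenceParity w (k % r) xor occurrenceParity w ((k + d) % r))
      ≡⟨ interchange (toℕ i ≡ᵇ k % r) _ _ _ ⟩
    occurrenceParity ((i , b) ∷ w) (k % r) xor occurrenceParity ((i , b) ∷ w) ((k + d) % r) ∎

  odometer∈G⇒2∣r/gcd : ∀ {γ} → InG r s γ → IsOdometer γ → 2 ∣ r / gcd r d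
  odometer∈G⇒2∣r/gcd {γ} γ∈G odometer = periodic∧alternates⇒2∣r/gcd colour-periodic colour-alternates
    where
    w : List (Letter r)
    w = proj₁ (γ∈G r)

    colour : ℕ → Bool
    colour y = occurrenceParity w (y % r)

    colour-periodic : Periodic r colour
    colour-periodic y = cong (occurrenceParity w) (m%n%n≡m%n y r)

    oddLevel : ∀ {k} → k < r → colour k xor colour (k + d) ≡ true
    oddLevel {k} k<r = begin
      colour k xor colour (k + d)    ≡⟨ levelParity-wordAut w k ⟨
      levelParity (wordAut r s w) k  ≡⟨ levelParity-cong k (portrait-≗-below γ (wordAut r s w) γ≗w k<r) ⟨
      levelParity γ k                ≡⟨ levelTransitive⇒oddLevelParity γ (odometer r (s≤s z≤n)) k<r ⟩
      true                           ∎
      where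
      γ≗w : act γ ≗[ r ] act (wordAut r s w)
      γ≗w v lv = trans (proj₂ (γ∈G r) v lv) (sym (act-wordAut r s w v))

    colour-alternates : Alternates d colour
    colour-alternates y = begin
      colour (y + d)        ≡⟨ cong (occurrenceParity w) ([m%n+k]%n≡[m+k]%n y d r) ⟨
      colour (y % r + d)    ≡⟨ xor≡true⇒≡not (colour (y % r)) (oddLevel (m%n<n y r)) ⟩
      not (colour (y % r))  ≡⟨ cong not (colour-periodic y) ⟩
      not (colour y)        ∎

  2∣r/gcd⇒odometer∈G : 2 ∣ r / gcd r d → ∃ λ γ → InG r s γ × IsOdometer γ
  2∣r/gcd⇒odometer∈G 2∣r/gcd =
    γ , wordAut∈G r s W , λ m _ → oddLevelParities⇒levelTransitive m γ (λ k _ → oddLevel k)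
    where
    open AlternatingColouring r d 2∣r/gcd

    W : List (Letter r)
    W = indicatorWord colour r ≤-refl

    γ : Aut
    γ = wordAut r s W

    occurrenceParity-W : ∀ t → occurrenceParity W (t % r) ≡ colour t
    occurrenceParity-W t =
      trans (occurrenceParity-indicatorWord-< colour r ≤-refl (m%n<n t r)) (colour-periodic t)

    oddLevel : ∀ k → levelParity γ k ≡ true
    oddLevel k = begin
      levelParity γ k
        ≡⟨ levelParity-wordAut W k ⟩
      occurrenceParity W (k % r) xor occurrenceParity W ((k + d) % r)
        ≡⟨ cong₂ _xor_ (occurrenceParity-W k) (occurrenceParity-W (k + d)) ⟩
      colour k xor colour (k + d)
        ≡⟨ cong (colour k xor_) (colour-alternates k) ⟩
      colour k xor not (colour k)
        ≡⟨ xor-inverseʳ (colour k) ⟩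
      true ∎

theorem5p3 : ∀ (r s : ℕ) → 3 ≤ r → 2 ≤ s → s ≤ r →
    ((∃ λ (γ : Aut) → InG r s γ × IsOdometer γ) ⇔
     ((2 ∣ r × 2 ∣ s) ⊎ (¬ (2 ∣ s) × 2 ∣ rOverGcd r (s ∸ 1))))
theorem5p3 (suc (suc (suc R))) (suc (suc S)) (s≤s (s≤s (s≤s z≤n))) (s≤s (s≤s z≤n)) (s≤s (s≤s S≤1+R)) =
  mk⇔ (λ (γ , γ∈G , odometer) → from (odometer∈G⇒2∣r/gcd γ∈G odometer)) (2∣r/gcd⇒odometer∈G ∘ to)
  where
  open Generators (suc R) S S≤1+R
  open Equivalence ([2∣m×2∣1+n]⊎[2∤1+n×2∣m/gcd]⇔2∣m/gcd r d)
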